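{- Let $P$ be a partial latin square of order $n$ such that all filled cells lie in the upper left $r\times s$ rectangle $R$ (for some $r,s\in\{1,\dots,n\}$), and every cell of $R$ is filled except for some empty cells, at most one in each column of $R$. Let $J$ be a subset of the empty cells of $R$. Let $H$ be the set of cells in the top $r$ rows, and for each $\sigma\in\{1,\dots,n\}$ let $\nu(\sigma)$ be the number of times $\sigma$ appears in $R$ and $\rho(\sigma)$ the number of rows containing an empty cell of $R$ not in $J$ that supports $\sigma$. Then \[\alpha(\sigma,H\setminus J)=\min\{r,\ \nu(\sigma)+\rho(\sigma)+n-s\}.\]
   Context: A partial latin square of order $n$ is an $n\times n$ array in which some cells are filled with symbols from $\{1,\dots,n\}$, no symbol appearing twice in any row or column. A symbol is missing from a row (column) if it does not appear in a filled cell of that row (column). A cell supports $\sigma$ if it contains $\sigma$, or it is empty and $\sigma$ is missing from both its row and its column. A set of cells is independent if no two lie in the same row or column; an independent set for $\sigma$ is an independent set all of whose cells support $\sigma$. $\alpha(\sigma,T)$ is the maximum size of a subset of $T$ that is an independent set for $\sigma$. -}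

module Defs where

open import Data.Nat using (ℕ; _+_; _∸_; _<_; _≤_; _⊓_; _<?_)
open import Data.Fin using (Fin; toℕ)
open import Data.Fin.Properties using (all?; any?)
open import Data.Maybe using (Maybe; just; nothing)
open import Data.Maybe.Properties using (≡-dec)
open import Data.Bool using (Bool; true; false)
open import Data.Bool.Properties using () renaming (_≟_ to _≟ᵇ_)
open import Data.Product using (Σ; _×_; _,_; proj₁; proj₂; ∃)
open import Data.Sum using (_⊎_)
open import Data.List using (List; length; filter; map; allFin)
open import Data.Nat.ListAction using (sum)
open import Data.List.Relation.Unary.All using (All)
open import Data.List.Relation.Unary.AllPairs using (AllPairs)
open import Relation.Nullary using (¬_; Dec)
open import Relation.Nullary.Decidable using (_×-dec_; _⊎-dec_; ¬?)
open import Relation.Binary.PropositionalEquality using (_≡_; _≢_)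
import Data.Fin.Properties as FinP

-- An n×n array of (possibly empty) cells with symbols in Fin n
-- (symbol k : Fin n stands for k+1 ∈ {1,…,n}).
Array : ℕ → Set
Array n = Fin n → Fin n → Maybe (Fin n)

IsPLS : ∀ {n} → Array n → Set
IsPLS {n} L =
  (∀ (i j j' : Fin n) (x : Fin n) → L i j ≡ just x → L i j' ≡ just x → j ≡ j') ×
  (∀ (i i' j : Fin n) (x : Fin n) → L i j ≡ just x → L i' j ≡ just x → i ≡ i')

Cell : ℕ → Set
Cell n = Fin n × Fin n

row : ∀ {n} → Cell n → Fin n
row = proj₁

col : ∀ {n} → Cell n → Fin n
col = proj₂

MissingRow : ∀ {n} → Array n → Fin n → Fin n → Set
MissingRow {n} L σ i = ∀ (j : Fin n) → L i j ≢ just σ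

MissingCol : ∀ {n} → Array n → Fin n → Fin n → Set
MissingCol {n} L σ j = ∀ (i : Fin n) → L i j ≢ just σ

Supports : ∀ {n} → Array n → Fin n → Cell n → Set
Supports L σ (i , j) =
  L i j ≡ just σ ⊎ (L i j ≡ nothing × MissingRow L σ i × MissingCol L σ j)

IndepFor : ∀ {n} → Array n → Fin n → (Cell n → Set) → List (Cell n) → Set
IndepFor L σ T cs =
  AllPairs (λ a b → row a ≢ row b × col a ≢ col b) cs ×
  All T cs × All (Supports L σ) cs

IsAlpha : ∀ {n} → Array n → Fin n → (Cell n → Set) → ℕ → Set
IsAlpha L σ T m =
  (Σ _ λ cs → IndepFor L σ T cs × length cs ≡ m) ×
  (∀ cs → IndepFor L σ T cs → length cs ≤ m)

InRect : ∀ {n} → ℕ → ℕ → Fin n → Fin n → Set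
InRect r s i j = toℕ i < r × toℕ j < s

supports? : ∀ {n} (L : Array n) (σ : Fin n) (c : Cell n) → Dec (Supports L σ c)
supports? {n} L σ (i , j) =
  ≡-dec FinP._≟_ (L i j) (just σ) ⊎-dec
  (≡-dec FinP._≟_ (L i j) nothing ×-dec
   (all? (λ j' → ¬? (≡-dec FinP._≟_ (L i j') (just σ))) ×-dec
    all? (λ i' → ¬? (≡-dec FinP._≟_ (L i' j) (just σ)))))

nu : ∀ {n} → Array n → ℕ → ℕ → Fin n → ℕ
nu {n} L r s σ =
  sum (map (λ i → length (filter (λ j →
         (toℕ i <? r) ×-dec (toℕ j <? s) ×-dec ≡-dec FinP._≟_ (L i j) (just σ))
       (allFin n))) (allFin n))

rho : ∀ {n} → Array n → ℕ → ℕ → (Fin n → Fin n → Bool) → Fin n → ℕ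
rho {n} L r s J σ =
  length (filter (λ i → any? (λ j →
      (toℕ i <? r) ×-dec (toℕ j <? s) ×-dec
      ≡-dec FinP._≟_ (L i j) nothing ×-dec
      (J i j ≟ᵇ false) ×-dec supports? L σ (i , j)))
    (allFin n))

-- An independent set in H ∖ J uses each of the top r rows at most once, and
-- each of its cells is a σ of R (at most one per row containing σ), an empty
-- cell of R outside J (at most one per row counted by ρ), or a cell in one of
-- the n − s columns right of R; this gives both upper bounds.  Conversely,
-- choose in every row either its σ or an empty cell of R outside J supporting
-- σ: the chosen columns are distinct, since a column of R holds at most one σ
-- and at most one empty cell, and a column containing σ supports no empty
-- cell.  The remaining top rows miss σ, so they can be matched with the
-- columns right of R, where every empty cell supports σ.
module Submission where

open import Defs
open import Data.Bool using (Bool; true; false)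
open import Data.Bool.Properties using () renaming (_≟_ to _≟ᵇ_)
open import Data.Fin using (Fin; toℕ; fromℕ<)
open import Data.Fin.Properties using (any?; toℕ-injective; toℕ-fromℕ<; toℕ<n)
  renaming (_≟_ to _≟ᶠ_)
open import Data.List using (List; []; _∷_; length; filter; map; _++_; zip; take; allFin; upTo)
open import Data.List.Membership.Propositional using (_∈_)
open import Data.List.Membership.Propositional.Properties
  using (∈-∃++; ∈-++⁻; ∈-++⁺ˡ; ∈-++⁺ʳ; ∈-map⁺; ∈-map⁻; ∈-filter⁺; ∈-filter⁻;
         ∈-allFin; ∈-upTo⁺; ∈-upTo⁻)
open import Data.List.Properties
  using (length-++; length-++-sucʳ; length-map; length-upTo; length-take; length-zipWith; filter-none)
open import Data.List.Relation.Binary.Subset.Propositional using (_⊆_)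
open import Data.List.Relation.Unary.All as All using (All; []; _∷_)
import Data.List.Relation.Unary.All.Properties as Allₚ
open import Data.List.Relation.Unary.AllPairs as AllPairs using (AllPairs; []; _∷_)
import Data.List.Relation.Unary.AllPairs.Properties as AllPairsₚ
open import Data.List.Relation.Unary.Any using (here; there)
open import Data.List.Relation.Unary.Unique.Propositional using (Unique)
import Data.List.Relation.Unary.Unique.Propositional.Properties as Uniqueₚ
open import Data.Maybe using (just; nothing)
open import Data.Maybe.Properties using (≡-dec)
open import Data.Nat using (ℕ; suc; _+_; _∸_; _≤_; _<_; _⊓_; z≤n; s≤s; _<?_; _≤?_)
open import Data.Nat.ListAction using (sum)
open import Data.Nat.Properties
open import Data.Product using (∃; _×_; _,_; proj₁; proj₂)
open import Data.Sum using (_⊎_; inj₁; inj₂)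
open import Data.Sum.Properties using (inj₂-injective)
open import Function using (_∘_)
open import Relation.Nullary using (¬_; Dec; yes; no; contradiction)
open import Relation.Nullary.Decidable using (_×-dec_; _⊎-dec_; ¬?)
open import Relation.Unary using (Pred; Decidable)
open import Relation.Binary.PropositionalEquality

module _ {a} {A : Set a} where

  Unique-⊆⇒length-≤ : {xs ys : List A} → Unique xs → xs ⊆ ys → length xs ≤ length ys
  Unique-⊆⇒length-≤ {[]} _ _ = z≤n
  Unique-⊆⇒length-≤ {x ∷ xs} (x∉xs ∷ xs!) xs⊆ys with ∈-∃++ (xs⊆ys (here refl))
  ... | us , vs , refl =
    ≤-trans (s≤s (Unique-⊆⇒length-≤ xs! xs⊆us++vs)) (≤-reflexive (sym (length-++-sucʳ us x vs)))
    where
    xs⊆us++vs : xs ⊆ us ++ vs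
    xs⊆us++vs {y} y∈xs with ∈-++⁻ us (xs⊆ys (there y∈xs))
    ... | inj₁ y∈us         = ∈-++⁺ˡ y∈us
    ... | inj₂ (here y≡x)   = contradiction (sym y≡x) (All.lookup x∉xs y∈xs)
    ... | inj₂ (there y∈vs) = ∈-++⁺ʳ us y∈vs

  module _ {p q} {P : Pred A p} {Q : Pred A q} (P? : Decidable P) (Q? : Decidable Q) where

    length-filter-⊎ : (∀ {x} → P x → ¬ Q x) → ∀ xs →
      length (filter (λ x → P? x ⊎-dec Q? x) xs) ≡ length (filter P? xs) + length (filter Q? xs)
    length-filter-⊎ _ [] = refl
    length-filter-⊎ P⇒¬Q (x ∷ xs) with P? x | Q? x
    ... | yes px | yes qx = contradiction qx (P⇒¬Q px)
    ... | yes _  | no _   = cong suc (length-filter-⊎ P⇒¬Q xs)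
    ... | no _   | yes _  = trans (cong suc (length-filter-⊎ P⇒¬Q xs)) (sym (+-suc _ _))
    ... | no _   | no _   = length-filter-⊎ P⇒¬Q xs

    length-filter-≤-split : ∀ xs →
      length (filter P? xs) ≤ length (filter Q? xs) + length (filter (λ x → P? x ×-dec ¬? (Q? x)) xs)
    length-filter-≤-split [] = z≤n
    length-filter-≤-split (x ∷ xs) with P? x | Q? x
    ... | yes _ | yes _ = s≤s (length-filter-≤-split xs)
    ... | yes _ | no _  = ≤-trans (s≤s (length-filter-≤-split xs)) (≤-reflexive (sym (+-suc _ _)))
    ... | no _  | yes _ = m≤n⇒m≤1+n (length-filter-≤-split xs)
    ... | no _  | no _  = length-filter-≤-split xs

  AllPairs-mapWithAll : ∀ {p r t} {P : Pred A p} {R : A → A → Set r} {T : A → A → Set t} →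
    (∀ {x y} → P x → P y → R x y → T x y) → ∀ {xs} → All P xs → AllPairs R xs → AllPairs T xs
  AllPairs-mapWithAll f [] [] = []
  AllPairs-mapWithAll f (px ∷ pxs) (rx ∷ rxs) =
    All.zipWith (λ (py , rxy) → f px py rxy) (pxs , rx) ∷ AllPairs-mapWithAll f pxs rxs

module _ {a b} {A : Set a} {B : Set b} where

  length-≤-by-injection : (f : A → B) {xs : List A} {ys : List B} →
    AllPairs (λ x y → f x ≢ f y) xs → All (λ x → f x ∈ ys) xs → length xs ≤ length ys
  length-≤-by-injection f {xs} {ys} f-distinct f∈ys =
    ≤-trans (≤-reflexive (sym (length-map f xs)))
            (Unique-⊆⇒length-≤ (AllPairsₚ.map⁺ f-distinct) image⊆ys)
    where
    image⊆ys : map f xs ⊆ ys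
    image⊆ys y∈image with ∈-map⁻ f y∈image
    ... | _ , x∈xs , refl = All.lookup f∈ys x∈xs

  module _ {p q} {P : Pred A p} {Q : Pred B q} where

    All-zip : ∀ {xs ys} → All P xs → All Q ys → All (λ xy → P (proj₁ xy) × Q (proj₂ xy)) (zip xs ys)
    All-zip [] _ = []
    All-zip (_ ∷ _) [] = []
    All-zip (px ∷ pxs) (qy ∷ qys) = (px , qy) ∷ All-zip pxs qys

  AllPairs-zip : ∀ {r t} {R : A → A → Set r} {T : B → B → Set t} {xs ys} →
    AllPairs R xs → AllPairs T ys →
    AllPairs (λ u v → R (proj₁ u) (proj₁ v) × T (proj₂ u) (proj₂ v)) (zip xs ys)
  AllPairs-zip [] _ = []
  AllPairs-zip (_ ∷ _) [] = []
  AllPairs-zip (rx ∷ rxs) (ty ∷ tys) = All-zip rx ty ∷ AllPairs-zip rxs tys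

length-≤-filter-allFin : ∀ {n p} {P : Pred (Fin n) p} (P? : Decidable P) {ks : List ℕ} →
  Unique ks → All (λ k → ∃ λ i → toℕ i ≡ k × P i) ks → length ks ≤ length (filter P? (allFin n))
length-≤-filter-allFin {n} P? {ks} ks! hits =
  ≤-trans (Unique-⊆⇒length-≤ ks! ks⊆) (≤-reflexive (length-map toℕ (filter P? (allFin n))))
  where
  ks⊆ : ks ⊆ map toℕ (filter P? (allFin n))
  ks⊆ k∈ks with All.lookup hits k∈ks
  ... | i , refl , pi = ∈-map⁺ toℕ (∈-filter⁺ P? (∈-allFin i) pi)

length-filter-toℕ<-≥ : ∀ {n r} → r ≤ n →
  r ≤ length (filter (λ (i : Fin n) → toℕ i <? r) (allFin n))
length-filter-toℕ<-≥ {n} {r} r≤n =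
  ≤-trans (≤-reflexive (sym (length-upTo r)))
          (length-≤-filter-allFin (λ i → toℕ i <? r) (Uniqueₚ.upTo⁺ r) (All.tabulate hit))
  where
  hit : ∀ {k} → k ∈ upTo r → ∃ λ (i : Fin n) → toℕ i ≡ k × toℕ i < r
  hit k∈ = fromℕ< k<n , toℕ-fromℕ< k<n , subst (_< r) (sym (toℕ-fromℕ< k<n)) k<r
    where
    k<r = ∈-upTo⁻ k∈
    k<n = <-≤-trans k<r r≤n

length-filter-≤toℕ-≥ : ∀ {n s} → s ≤ n →
  n ∸ s ≤ length (filter (λ (j : Fin n) → s ≤? toℕ j) (allFin n))
length-filter-≤toℕ-≥ {n} {s} s≤n =
  ≤-trans (≤-reflexive (sym (trans (length-map (s +_) (upTo (n ∸ s))) (length-upTo (n ∸ s)))))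
          (length-≤-filter-allFin (λ j → s ≤? toℕ j) shifted! (All.tabulate hit))
  where
  shifted! : Unique (map (s +_) (upTo (n ∸ s)))
  shifted! = Uniqueₚ.map⁺ (+-cancelˡ-≡ s _ _) (Uniqueₚ.upTo⁺ (n ∸ s))

  hit : ∀ {k} → k ∈ map (s +_) (upTo (n ∸ s)) → ∃ λ (j : Fin n) → toℕ j ≡ k × s ≤ toℕ j
  hit k∈ with ∈-map⁻ (s +_) k∈
  ... | x , x∈ , refl = fromℕ< k<n , toℕ-fromℕ< k<n , subst (s ≤_) (sym (toℕ-fromℕ< k<n)) (m≤m+n s x)
    where
    k<n : s + x < n
    k<n = subst (s + x <_) (m+[n∸m]≡n s≤n) (+-monoʳ-< s (∈-upTo⁻ x∈))

module Rectangle {n : ℕ} (L : Array n) (isPLS : IsPLS L) {r s : ℕ} (r≤n : r ≤ n) (s≤n : s ≤ n)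
    (filled⇒inR : ∀ (i j : Fin n) (x : Fin n) → L i j ≡ just x → InRect r s i j)
    (one-hole-per-column : ∀ (i i' j : Fin n) → InRect r s i j → InRect r s i' j →
      L i j ≡ nothing → L i' j ≡ nothing → i ≡ i')
    (J : Fin n → Fin n → Bool)
    (J⇒hole : ∀ (i j : Fin n) → J i j ≡ true → InRect r s i j × L i j ≡ nothing)
    (σ : Fin n) where

  ν ρ : ℕ
  ν = nu L r s σ
  ρ = rho L r s J σ

  InH∖J : Cell n → Set
  InH∖J c = toℕ (row c) < r × J (row c) (col c) ≡ false

  Independent : Cell n → Cell n → Set
  Independent a b = row a ≢ row b × col a ≢ col b

  σInR : Fin n → Fin n → Set
  σInR i j = toℕ i < r × toℕ j < s × L i j ≡ just σ

  σInR? : ∀ i j → Dec (σInR i j)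
  σInR? i j = (toℕ i <? r) ×-dec (toℕ j <? s) ×-dec ≡-dec _≟ᶠ_ (L i j) (just σ)

  OpenHole : Fin n → Fin n → Set
  OpenHole i j = toℕ i < r × toℕ j < s × L i j ≡ nothing × J i j ≡ false × Supports L σ (i , j)

  openHole? : ∀ i j → Dec (OpenHole i j)
  openHole? i j = (toℕ i <? r) ×-dec (toℕ j <? s) ×-dec ≡-dec _≟ᶠ_ (L i j) nothing ×-dec
                  (J i j ≟ᵇ false) ×-dec supports? L σ (i , j)

  just≢nothing : just σ ≢ nothing
  just≢nothing ()

  RowHasσ : Fin n → Set
  RowHasσ i = ∃ (σInR i)

  rowHasσ? : ∀ i → Dec (RowHasσ i)
  rowHasσ? i = any? (σInR? i)

  RowHasOpenHole : Fin n → Set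
  RowHasOpenHole i = ∃ (OpenHole i)

  rowHasOpenHole? : ∀ i → Dec (RowHasOpenHole i)
  rowHasOpenHole? i = any? (openHole? i)

  σRows openHoleRows : List (Fin n)
  σRows        = filter rowHasσ? (allFin n)
  openHoleRows = filter rowHasOpenHole? (allFin n)

  filled-σ⇒σInR : ∀ {i j} → L i j ≡ just σ → σInR i j
  filled-σ⇒σInR {i} {j} Lij≡σ = let (i<r , j<s) = filled⇒inR i j σ Lij≡σ in i<r , j<s , Lij≡σ

  rowHasσ⇒¬rowHasOpenHole : ∀ {i} → RowHasσ i → ¬ RowHasOpenHole i
  rowHasσ⇒¬rowHasOpenHole _ (_ , _ , _ , Lij≡∅ , _ , inj₁ Lij≡σ) =
    just≢nothing (trans (sym Lij≡σ) Lij≡∅)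
  rowHasσ⇒¬rowHasOpenHole (j , _ , _ , Lij≡σ) (_ , _ , _ , _ , _ , inj₂ (_ , σ∉row , _)) =
    σ∉row j Lij≡σ

  length-filter-σInR : ∀ {i} → RowHasσ i → length (filter (σInR? i) (allFin n)) ≡ 1
  length-filter-σInR {i} (j , σij) =
    ≤-antisym (Unique-⊆⇒length-≤ (Uniqueₚ.filter⁺ (σInR? i) {allFin n} (Uniqueₚ.allFin⁺ n)) ⊆[j])
              (Unique-⊆⇒length-≤ ([] ∷ []) [j]⊆)
    where
    ⊆[j] : filter (σInR? i) (allFin n) ⊆ j ∷ []
    ⊆[j] j'∈ with ∈-filter⁻ (σInR? i) {xs = allFin n} j'∈
    ... | _ , _ , _ , Lij'≡σ = here (proj₁ isPLS i _ j σ Lij'≡σ (proj₂ (proj₂ σij)))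

    [j]⊆ : j ∷ [] ⊆ filter (σInR? i) (allFin n)
    [j]⊆ (here refl) = ∈-filter⁺ (σInR? i) (∈-allFin j) σij

  ν≡length-σRows : ν ≡ length σRows
  ν≡length-σRows = sum≡ (allFin n)
    where
    sum≡ : ∀ is → sum (map (λ i → length (filter (σInR? i) (allFin n))) is) ≡ length (filter rowHasσ? is)
    sum≡ [] = refl
    sum≡ (i ∷ is) with rowHasσ? i
    ... | yes hasσ = cong₂ _+_ (length-filter-σInR hasσ) (sum≡ is)
    ... | no ¬hasσ =
      cong₂ _+_ (cong length (filter-none (σInR? i) {allFin n} (All.tabulate λ _ → ¬hasσ ∘ (_ ,_)))) (sum≡ is)

  notHole⇒J≡false : ∀ {i j} → ¬ (InRect r s i j × L i j ≡ nothing) → J i j ≡ false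
  notHole⇒J≡false {i} {j} ¬hole with J i j in Jij
  ... | false = refl
  ... | true  = contradiction (J⇒hole i j Jij) ¬hole

  right-of-R-empty : ∀ i j → s ≤ toℕ j → L i j ≡ nothing
  right-of-R-empty i j s≤j with L i j in Lij
  ... | nothing = refl
  ... | just x  = contradiction (proj₂ (filled⇒inR i j x Lij)) (≤⇒≯ s≤j)

  right-of-R-supports : ∀ {i j} → toℕ i < r → ¬ RowHasσ i → s ≤ toℕ j →
                        InH∖J (i , j) × Supports L σ (i , j)
  right-of-R-supports {i} {j} i<r ¬hasσ s≤j =
    (i<r , notHole⇒J≡false λ ((_ , j<s) , _) → <⇒≱ j<s s≤j) ,
    inj₂ (right-of-R-empty i j s≤j , σ∉row , σ∉col)
    where
    σ∉row : MissingRow L σ i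
    σ∉row j' Lij'≡σ = ¬hasσ (j' , filled-σ⇒σInR Lij'≡σ)

    σ∉col : MissingCol L σ j
    σ∉col i' Li'j≡σ = <⇒≱ (proj₂ (filled⇒inR i' j σ Li'j≡σ)) s≤j

  Admissible : Cell n → Set
  Admissible c = InRect r s (row c) (col c) × J (row c) (col c) ≡ false × Supports L σ c

  admissible-distinct-cols : ∀ {a b} → Admissible a → Admissible b → row a ≢ row b → col a ≢ col b
  admissible-distinct-cols {i , j} {i' , .j} (_ , _ , inj₁ Lij≡σ) (_ , _ , inj₁ Li'j≡σ) i≢i' refl =
    i≢i' (proj₂ isPLS i i' j σ Lij≡σ Li'j≡σ)
  admissible-distinct-cols {i , j} {i' , .j} (_ , _ , inj₁ Lij≡σ) (_ , _ , inj₂ (_ , _ , σ∉col)) _ refl =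
    σ∉col i Lij≡σ
  admissible-distinct-cols {i , j} {i' , .j} (_ , _ , inj₂ (_ , _ , σ∉col)) (_ , _ , inj₁ Li'j≡σ) _ refl =
    σ∉col i' Li'j≡σ
  admissible-distinct-cols {i , j} {i' , .j} (inR , _ , inj₂ (Lij≡∅ , _)) (inR' , _ , inj₂ (Li'j≡∅ , _))
                           i≢i' refl =
    i≢i' (one-hole-per-column i i' j inR inR' Lij≡∅ Li'j≡∅)

  Picked : Fin n → Set
  Picked i = RowHasσ i ⊎ RowHasOpenHole i

  picked? : ∀ i → Dec (Picked i)
  picked? i = rowHasσ? i ⊎-dec rowHasOpenHole? i

  -- On rows that are not picked the value is irrelevant.
  pickedCol : Fin n → Fin n
  pickedCol i with rowHasσ? i | rowHasOpenHole? i
  ... | yes (j , _) | _           = j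
  ... | no _        | yes (j , _) = j
  ... | no _        | no _        = i

  pickedCell-admissible : ∀ {i} → Picked i → Admissible (i , pickedCol i)
  pickedCell-admissible {i} picked with rowHasσ? i | rowHasOpenHole? i | picked
  ... | yes (j , i<r , j<s , Lij≡σ) | _ | _ =
    (i<r , j<s) , notHole⇒J≡false (λ (_ , Lij≡∅) → just≢nothing (trans (sym Lij≡σ) Lij≡∅)) , inj₁ Lij≡σ
  ... | no _ | yes (j , i<r , j<s , _ , Jij≡false , supports) | _ = (i<r , j<s) , Jij≡false , supports
  ... | no ¬hasσ | no _ | inj₁ hasσ = contradiction hasσ ¬hasσ
  ... | no _ | no ¬hasHole | inj₂ hasHole = contradiction hasHole ¬hasHole

  pickedRows freeRows rightCols : List (Fin n)
  pickedRows = filter picked? (allFin n)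
  freeRows   = filter (λ i → (toℕ i <? r) ×-dec ¬? (picked? i)) (allFin n)
  rightCols  = filter (λ j → s ≤? toℕ j) (allFin n)

  pickedCells freeCells : List (Cell n)
  pickedCells = map (λ i → i , pickedCol i) pickedRows
  freeCells   = zip freeRows rightCols

  pickedCells-picked : All (Picked ∘ row) pickedCells
  pickedCells-picked = Allₚ.map⁺ (Allₚ.all-filter picked? (allFin n))

  pickedCells-admissible : All Admissible pickedCells
  pickedCells-admissible = Allₚ.map⁺ (All.map pickedCell-admissible (Allₚ.all-filter picked? (allFin n)))

  freeCells-shape : All (λ c → (toℕ (row c) < r × ¬ Picked (row c)) × s ≤ toℕ (col c)) freeCells
  freeCells-shape = All-zip (Allₚ.all-filter _ (allFin n)) (Allₚ.all-filter _ (allFin n))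

  pickedCells-independent : AllPairs Independent pickedCells
  pickedCells-independent =
    AllPairsₚ.map⁺ (AllPairs-mapWithAll
      (λ pi pi' i≢i' →
        i≢i' , admissible-distinct-cols (pickedCell-admissible pi) (pickedCell-admissible pi') i≢i')
      (Allₚ.all-filter picked? (allFin n))
      (Uniqueₚ.filter⁺ picked? (Uniqueₚ.allFin⁺ n)))

  freeCells-independent : AllPairs Independent freeCells
  freeCells-independent =
    AllPairs-zip (Uniqueₚ.filter⁺ _ (Uniqueₚ.allFin⁺ n)) (Uniqueₚ.filter⁺ _ (Uniqueₚ.allFin⁺ n))

  picked-free-independent : All (λ a → All (Independent a) freeCells) pickedCells
  picked-free-independent =
    All.zipWith (λ (picked , admissible) → All.map (apart picked admissible) freeCells-shape)
                (pickedCells-picked , pickedCells-admissible)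
    where
    apart : ∀ {a b} → Picked (row a) → Admissible a →
            (toℕ (row b) < r × ¬ Picked (row b)) × s ≤ toℕ (col b) → Independent a b
    apart picked ((_ , j<s) , _) ((_ , ¬picked) , s≤j) =
      (λ { refl → ¬picked picked }) , (λ { refl → <⇒≱ j<s s≤j })

  witness : List (Cell n)
  witness = pickedCells ++ freeCells

  witness-independent : AllPairs Independent witness
  witness-independent = AllPairsₚ.++⁺ pickedCells-independent freeCells-independent picked-free-independent

  witness-supports : All (λ c → InH∖J c × Supports L σ c) witness
  witness-supports =
    Allₚ.++⁺ (All.map (λ ((i<r , _) , Jij≡false , supports) → (i<r , Jij≡false) , supports)
                      pickedCells-admissible)
             (All.map (λ ((i<r , ¬picked) , s≤j) → right-of-R-supports i<r (¬picked ∘ inj₁) s≤j)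
                      freeCells-shape)

  length-pickedCells : length pickedCells ≡ ν + ρ
  length-pickedCells = begin
    length pickedCells  ≡⟨ length-map _ pickedRows ⟩
    length pickedRows   ≡⟨ length-filter-⊎ rowHasσ? rowHasOpenHole? rowHasσ⇒¬rowHasOpenHole (allFin n) ⟩
    length σRows + length openHoleRows
                        ≡⟨ cong (_+ ρ) ν≡length-σRows ⟨
    ν + ρ ∎
    where open ≡-Reasoning

  length-witness :
    length witness ≡ (length pickedCells + length freeRows) ⊓ (length pickedCells + length rightCols)
  length-witness = begin
    length witness
      ≡⟨ length-++ pickedCells ⟩
    length pickedCells + length freeCells
      ≡⟨ cong (length pickedCells +_) (length-zipWith _,_ freeRows rightCols) ⟩
    length pickedCells + length freeRows ⊓ length rightCols
      ≡⟨ +-distribˡ-⊓ (length pickedCells) _ _ ⟩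
    (length pickedCells + length freeRows) ⊓ (length pickedCells + length rightCols) ∎
    where open ≡-Reasoning

  bound≤length-witness : r ⊓ (ν + ρ + (n ∸ s)) ≤ length witness
  bound≤length-witness = ≤-trans (⊓-mono-≤ r≤ bound≤) (≤-reflexive (sym length-witness))
    where
    r≤ : r ≤ length pickedCells + length freeRows
    r≤ = ≤-trans (length-filter-toℕ<-≥ r≤n)
                 (subst (λ k → _ ≤ k + length freeRows) (sym (length-map _ pickedRows))
                        (length-filter-≤-split _ picked? (allFin n)))

    bound≤ : ν + ρ + (n ∸ s) ≤ length pickedCells + length rightCols
    bound≤ = +-mono-≤ (≤-reflexive (sym length-pickedCells)) (length-filter-≤toℕ-≥ s≤n)

  Slot : Set
  Slot = Fin n ⊎ Fin n ⊎ ℕ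

  slot : Cell n → Slot
  slot (i , j) with ≡-dec _≟ᶠ_ (L i j) (just σ) | toℕ j <? s
  ... | yes _ | _     = inj₁ i
  ... | no _  | yes _ = inj₂ (inj₁ i)
  ... | no _  | no _  = inj₂ (inj₂ (toℕ j ∸ s))

  slots : List Slot
  slots = map inj₁ σRows ++ map (inj₂ ∘ inj₁) openHoleRows ++ map (inj₂ ∘ inj₂) (upTo (n ∸ s))

  length-slots : length slots ≡ ν + ρ + (n ∸ s)
  length-slots =
    trans (length-++ (map inj₁ σRows))
      (trans (cong₂ _+_ (trans (length-map inj₁ σRows) (sym ν≡length-σRows))
                        (trans (length-++ (map (inj₂ ∘ inj₁) openHoleRows))
                               (cong₂ _+_ (length-map _ openHoleRows)
                                          (trans (length-map _ (upTo (n ∸ s))) (length-upTo (n ∸ s))))))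
             (sym (+-assoc ν ρ (n ∸ s))))

  slot∈slots : ∀ {c} → InH∖J c → Supports L σ c → slot c ∈ slots
  slot∈slots {i , j} (i<r , Jij≡false) supports with ≡-dec _≟ᶠ_ (L i j) (just σ) | toℕ j <? s
  ... | yes Lij≡σ | _ =
    ∈-++⁺ˡ (∈-map⁺ inj₁ (∈-filter⁺ rowHasσ? (∈-allFin i) (j , filled-σ⇒σInR Lij≡σ)))
  ... | no Lij≢σ | yes j<s =
    ∈-++⁺ʳ (map inj₁ σRows) (∈-++⁺ˡ (∈-map⁺ (inj₂ ∘ inj₁)
      (∈-filter⁺ rowHasOpenHole? (∈-allFin i) (j , i<r , j<s , empty supports , Jij≡false , supports))))
    where
    empty : Supports L σ (i , j) → L i j ≡ nothing
    empty (inj₁ Lij≡σ)           = contradiction Lij≡σ Lij≢σ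
    empty (inj₂ (Lij≡∅ , _ , _)) = Lij≡∅
  ... | no _ | no j≮s =
    ∈-++⁺ʳ (map inj₁ σRows) (∈-++⁺ʳ (map (inj₂ ∘ inj₁) openHoleRows)
      (∈-map⁺ (inj₂ ∘ inj₂) (∈-upTo⁺ (∸-monoˡ-< (toℕ<n j) (≮⇒≥ j≮s)))))

  slot-injective : ∀ {a b} → Independent a b → slot a ≢ slot b
  slot-injective {i , j} {i' , j'} (i≢i' , j≢j')
    with ≡-dec _≟ᶠ_ (L i j) (just σ) | toℕ j <? s | ≡-dec _≟ᶠ_ (L i' j') (just σ) | toℕ j' <? s
  ... | yes _ | _     | yes _ | _     = λ { refl → i≢i' refl }
  ... | yes _ | _     | no _  | yes _ = λ ()
  ... | yes _ | _     | no _  | no _  = λ ()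
  ... | no _  | yes _ | yes _ | _     = λ ()
  ... | no _  | yes _ | no _  | yes _ = λ { refl → i≢i' refl }
  ... | no _  | yes _ | no _  | no _  = λ ()
  ... | no _  | no _  | yes _ | _     = λ ()
  ... | no _  | no _  | no _  | yes _ = λ ()
  ... | no _  | no j≮s | no _  | no j'≮s = λ eq →
    j≢j' (toℕ-injective (∸-cancelʳ-≡ (≮⇒≥ j≮s) (≮⇒≥ j'≮s) (inj₂-injective (inj₂-injective eq))))

  independent-size≤ : ∀ cs → IndepFor L σ InH∖J cs → length cs ≤ r ⊓ (ν + ρ + (n ∸ s))
  independent-size≤ cs (independent , inH∖J , supports) = ⊓-glb ≤r ≤slots
    where
    ≤r : length cs ≤ r
    ≤r = ≤-trans (length-≤-by-injection (toℕ ∘ row) {ys = upTo r}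
                   (AllPairs.map (λ (i≢i' , _) → i≢i' ∘ toℕ-injective) independent)
                   (All.map (∈-upTo⁺ ∘ proj₁) inH∖J))
                 (≤-reflexive (length-upTo r))

    ≤slots : length cs ≤ ν + ρ + (n ∸ s)
    ≤slots = ≤-trans (length-≤-by-injection slot (AllPairs.map slot-injective independent)
                       (All.zipWith (λ (h , sup) → slot∈slots h sup) (inH∖J , supports)))
                     (≤-reflexive length-slots)

  α≡bound : IsAlpha L σ InH∖J (r ⊓ (ν + ρ + (n ∸ s)))
  α≡bound =
    (take m witness ,
     (AllPairsₚ.take⁺ m witness-independent ,
      Allₚ.take⁺ m (All.map proj₁ witness-supports) ,
      Allₚ.take⁺ m (All.map proj₂ witness-supports)) ,
     trans (length-take m witness) (m≤n⇒m⊓n≡m bound≤length-witness)) ,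
    independent-size≤
    where
    m = r ⊓ (ν + ρ + (n ∸ s))

lemma6 : (n : ℕ) (L : Array n) → IsPLS L →
    (r s : ℕ) → 1 ≤ r → r ≤ n → 1 ≤ s → s ≤ n →
    (∀ (i j : Fin n) (x : Fin n) → L i j ≡ just x → InRect r s i j) →
    (∀ (i i' j : Fin n) → InRect r s i j → InRect r s i' j →
      L i j ≡ nothing → L i' j ≡ nothing → i ≡ i') →
    (J : Fin n → Fin n → Bool) →
    (∀ (i j : Fin n) → J i j ≡ true → InRect r s i j × L i j ≡ nothing) →
    (σ : Fin n) →
    IsAlpha L σ (λ c → (toℕ (row c) < r) × J (row c) (col c) ≡ false)
      (r ⊓ (nu L r s σ + rho L r s J σ + (n ∸ s)))
lemma6 n L isPLS r s _ r≤n _ s≤n filled⇒inR one-hole-per-column J J⇒hole σ =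
  Rectangle.α≡bound L isPLS r≤n s≤n filled⇒inR one-hole-per-column J J⇒hole σ
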